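{- Let $G=(V,E)$ be a nontrivial (finite, simple, connected) graph of order $n$ such that $\tau(G)=\tau>\frac{n}{2}$, and suppose its $\tau$-set $W$ satisfies $G[W]\cong K_\tau$. Then: (a) if $G$ contains a $W$-distinguishing vertex, then $\beta_p(G)=\tau+1$; (b) if $G[N(W)\setminus W]$ contains an isolated vertex, then $\beta_p(G)=\tau+1$; (c) if $|N(W)\setminus W|=1$, then $\beta_p(G)=\tau+1$; (d) if $G[N(W)\setminus W]$ contains a universal vertex $v$ (i.e. $v$ adjacent to all other vertices of $N(W)\setminus W$), then $v$ is adjacent to at least one vertex of $V\setminus N[W]$.
   Context: Two vertices $u,v$ are twins if $N(u)\setminus\{v\}=N(v)\setminus\{u\}$. A twin set is a set of pairwise twin vertices; twin classes are the equivalence classes of the twin relation and $\tau(G)$ is the maximum cardinality of a twin class. A $\tau$-set is a twin set of cardinality $\tau(G)$ (when $\tau(G)>n/2$ it is unique). For $W\subseteq V$, $N(W)=\bigcup_{v\in W}N(v)$ and $N[W]=N(W)\cup W$; $G[X]$ is the induced subgraph on $X$. For $u$ a vertex and $S$ a vertex set, $d(u,S)=\min_{w\in S}d(u,w)$. A vertex $v\in V\setminus W$ is $W$-distinguishing if $d(v,z)\ne d(v,W)$ for every $z\in N(W)\setminus W$. A partition $\Pi=\{S_1,\dots,S_k\}$ of $V$ is locating if the vectors $r(u|\Pi)=(d(u,S_1),\dots,d(u,S_k))$ are pairwise distinct over $u\in V$; $\beta_p(G)$ is the minimum size of a locating partition. -}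

module Defs where

open import Level using (0ℓ)
open import Data.Nat using (ℕ; zero; suc; _+_; _*_; _≤_; _<_)
open import Data.Fin using (Fin)
open import Data.Fin.Subset using (Subset; _∈_; _∉_; ∣_∣)
open import Data.Sum using (_⊎_)
open import Data.Product using (Σ; ∃; ∃-syntax; _×_; _,_)
open import Relation.Nullary using (¬_; Dec)
open import Relation.Binary.PropositionalEquality using (_≡_; _≢_)
open import Function.Bundles using (_⇔_)

record Graph (n : ℕ) : Set₁ where
  field
    Adj     : Fin n → Fin n → Set
    adj-dec : ∀ u v → Dec (Adj u v)
    sym     : ∀ {u v} → Adj u v → Adj v u
    irrefl  : ∀ {u} → ¬ Adj u u

module _ {n : ℕ} (G : Graph n) where
  open Graph G

  data Walk : Fin n → Fin n → ℕ → Set where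
    here  : ∀ {u} → Walk u u zero
    step  : ∀ {u w v k} → Adj u w → Walk w v k → Walk u v (suc k)

  Connected : Set
  Connected = ∀ u v → ∃[ k ] Walk u v k

  Dist : Fin n → Fin n → ℕ → Set
  Dist u v k = Walk u v k × (∀ m → Walk u v m → k ≤ m)

  SetDist : Fin n → (Fin n → Set) → ℕ → Set
  SetDist u S k = (∃[ w ] (S w × Dist u w k))
                × (∀ w m → S w → Dist u w m → k ≤ m)

  Twins : Fin n → Fin n → Set
  Twins u v = ∀ x → (Adj u x × x ≢ v) ⇔ (Adj v x × x ≢ u)

  TwinSet : Subset n → Set
  TwinSet W = ∀ u v → u ∈ W → v ∈ W → u ≢ v → Twins u v

  TwinClass : Subset n → Set
  TwinClass W = ∃[ u ] (u ∈ W × (∀ v → (v ∈ W) ⇔ (v ≡ u ⊎ Twins u v)))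

  TwinNumber : ℕ → Set
  TwinNumber t = (∃[ W ] (TwinClass W × ∣ W ∣ ≡ t))
               × (∀ W → TwinClass W → ∣ W ∣ ≤ t)

  NbhdMinus : Subset n → Fin n → Set
  NbhdMinus W z = z ∉ W × (∃[ w ] (w ∈ W × Adj w z))

  ClosedNbhd : Subset n → Fin n → Set
  ClosedNbhd W z = z ∈ W ⊎ (∃[ w ] (w ∈ W × Adj w z))

  Distinguishing : Subset n → Fin n → Set
  Distinguishing W v = v ∉ W ×
    (∀ z a b → NbhdMinus W z → Dist v z a → SetDist v (λ x → x ∈ W) b → a ≢ b)

  -- A partition of V into k (nonempty) classes S_i = { u | f u ≡ i }
  IsPartition : (k : ℕ) → (Fin n → Fin k) → Set
  IsPartition k f = ∀ i → ∃[ u ] (f u ≡ i)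

  -- locating: the distance vectors r(u|Π) are pairwise distinct
  Locating : (k : ℕ) → (Fin n → Fin k) → Set
  Locating k f = IsPartition k f ×
    (∀ u v → u ≢ v → ∃[ i ] ∃[ a ] ∃[ b ]
       (SetDist u (λ x → f x ≡ i) a × SetDist v (λ x → f x ≡ i) b × a ≢ b))

  PartitionDim : ℕ → Set
  PartitionDim k = (∃[ f ] Locating k f)
                 × (∀ m (f : Fin n → Fin m) → Locating m f → k ≤ m)

module Submission where

-- Twins have the same distance to every class not containing them,
--   so a locating partition puts the vertices of W into pairwise distinct classes.
--   With only τ classes every class then meets W, and a vertex of N(W) \ W (which is
--   adjacent to all of W) is at distance 0 or 1 from every class exactly like the
--   vertex of W in its own class.  Hence β_p(G) ≥ τ + 1.
-- * Upper bound.  For a W-distinguishing vertex v take the classes {v} and, for each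
--   w ∈ W, a class containing w and at most one vertex outside W; since
--   |V \ W| < |W| one "spare" class contains no vertex outside W.  A vertex of
--   N(W) \ W is separated from its W-partner by the class {v}, any other vertex by
--   the spare class.  This gives (a); (b) and (c) follow because an isolated vertex
--   of G[N(W) \ W] is W-distinguishing.
-- * Part (d).  A universal vertex of G[N(W) \ W] without neighbours outside N[W]
--   would be a twin of the vertices of W, enlarging the maximum twin class.

open import Defs
open import Data.Nat using (ℕ; zero; suc; _+_; _*_; _∸_; _≤_; _<_; _≤?_; z≤n; s≤s)
open import Data.Nat.Properties
  using (≤-refl; ≤-trans; ≤-antisym; <-irrefl; ≮⇒≥; ≰⇒>; m≤n⇒m<n∨m≡n; m<1+n⇒m≤n; n≤1+n;
         <-≤-trans; ≤-<-trans; <⇒≤; +-identityʳ; m<n+o⇒m∸n<o)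
open import Data.Fin using (Fin; zero; suc; toℕ; fromℕ<; inject≤; punchOut) renaming (_≟_ to _≟ᶠ_)
open import Data.Fin.Properties
  using (any?; all?; suc-injective; toℕ<n; toℕ-fromℕ<; toℕ-inject≤; inject≤-injective;
         punchOut-injective; injective⇒≤)
open import Data.Fin.Subset using (Subset; _∈_; _∉_; ∣_∣; ∁; inside; outside)
open import Data.Fin.Subset.Properties using (_∈?_; p⊂q⇒∣p∣<∣q∣; x∉p⇒x∈∁p; ∣∁p∣≡n∸∣p∣)
open import Data.Vec using ([]; _∷_; here; there; tabulate)
open import Data.Vec.Properties using ([]=⇒lookup; lookup⇒[]=; lookup∘tabulate)
open import Data.Product using (∃-syntax; _×_; _,_; proj₁; proj₂)
open import Data.Sum using (_⊎_; inj₁; inj₂)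
open import Data.Empty using (⊥-elim)
open import Relation.Nullary using (¬_; Dec; yes; no; does)
open import Relation.Nullary.Decidable
  using (map′; _×-dec_; _⊎-dec_; _→-dec_; ¬?; dec-true; decidable-stable)
open import Relation.Binary.PropositionalEquality
  using (_≡_; _≢_; refl; sym; trans; cong; subst)
open import Function.Bundles using (_⇔_; mk⇔; Equivalence)
open import Function.Construct.Symmetry using (⇔-sym)
open Equivalence using (to; from)

IsLeast : (ℕ → Set) → ℕ → Set
IsLeast P m = P m × (∀ k → P k → m ≤ k)

module _ {P : ℕ → Set} (P? : ∀ k → Dec (P k)) where

  searchBelow : ∀ b → (∃[ m ] IsLeast P m) ⊎ (∀ k → k < b → ¬ P k)
  searchBelow zero = inj₂ (λ k ())
  searchBelow (suc b) with searchBelow b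
  ... | inj₁ found = inj₁ found
  ... | inj₂ none with P? b
  ...   | yes pb = inj₁ (b , pb , λ k pk → ≮⇒≥ (λ k<b → none k k<b pk))
  ...   | no ¬pb = inj₂ noneBelow
    where
    noneBelow : ∀ k → k < suc b → ¬ P k
    noneBelow k k<1+b with m≤n⇒m<n∨m≡n (m<1+n⇒m≤n k<1+b)
    ... | inj₁ k<b = none k k<b
    ... | inj₂ refl = ¬pb

  least : ∀ {k} → P k → ∃[ m ] IsLeast P m
  least {k} pk with searchBelow (suc k)
  ... | inj₁ found = found
  ... | inj₂ none = ⊥-elim (none k ≤-refl pk)

_⇔?_ : {A B : Set} → Dec A → Dec B → Dec (A ⇔ B)
a? ⇔? b? = map′ (λ (f , g) → mk⇔ f g) (λ e → to e , from e) ((a? →-dec b?) ×-dec (b? →-dec a?))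

subsetOf : ∀ {n} {P : Fin n → Set} → (∀ x → Dec (P x)) → Subset n
subsetOf P? = tabulate (λ x → does (P? x))

∈subsetOf⇔ : ∀ {n} {P : Fin n → Set} (P? : ∀ x → Dec (P x)) x → x ∈ subsetOf P? ⇔ P x
∈subsetOf⇔ {P = P} P? x = mk⇔ member⇒P P⇒member
  where
  member⇒P : x ∈ subsetOf P? → P x
  member⇒P x∈ with P? x | trans (sym (lookup∘tabulate _ x)) ([]=⇒lookup x∈)
  ... | yes px | _ = px
  ... | no _   | ()
  P⇒member : P x → x ∈ subsetOf P?
  P⇒member px = lookup⇒[]= x _ (trans (lookup∘tabulate _ x) (dec-true (P? x) px))

InjectiveOn : ∀ {n m} → Subset n → (Fin n → Fin m) → Set
InjectiveOn p g = ∀ {x y} → x ∈ p → y ∈ p → g x ≡ g y → x ≡ y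

record Enumeration {n} (p : Subset n) : Set where
  field
    elem       : Fin ∣ p ∣ → Fin n
    elem∈      : ∀ k → elem k ∈ p
    elem-inj   : ∀ {k l} → elem k ≡ elem l → k ≡ l
    index      : ∀ {x} → x ∈ p → Fin ∣ p ∣
    elem-index : ∀ {x} (x∈p : x ∈ p) → elem (index x∈p) ≡ x

enumerate : ∀ {n} (p : Subset n) → Enumeration p
enumerate [] = record
  { elem = λ () ; elem∈ = λ () ; elem-inj = λ { {()} } ; index = λ () ; elem-index = λ () }
enumerate (outside ∷ p) = record
  { elem       = λ k → suc (elem k)
  ; elem∈      = λ k → there (elem∈ k)
  ; elem-inj   = λ eq → elem-inj (suc-injective eq)
  ; index      = λ { (there x∈p) → index x∈p }
  ; elem-index = λ { (there x∈p) → cong suc (elem-index x∈p) }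
  }
  where open Enumeration (enumerate p)
enumerate {suc n} (inside ∷ p) = record
  { elem = elem′ ; elem∈ = elem∈′ ; elem-inj = elem-inj′
  ; index = index′ ; elem-index = elem-index′ }
  where
  open Enumeration (enumerate p)
  elem′ : Fin (suc ∣ p ∣) → Fin (suc n)
  elem′ zero    = zero
  elem′ (suc k) = suc (elem k)
  elem∈′ : ∀ k → elem′ k ∈ inside ∷ p
  elem∈′ zero    = here
  elem∈′ (suc k) = there (elem∈ k)
  elem-inj′ : ∀ {k l} → elem′ k ≡ elem′ l → k ≡ l
  elem-inj′ {zero}  {zero}  _  = refl
  elem-inj′ {suc k} {suc l} eq = cong suc (elem-inj (suc-injective eq))
  elem-inj′ {zero}  {suc l} ()
  elem-inj′ {suc k} {zero}  ()
  index′ : ∀ {x} → x ∈ inside ∷ p → Fin (suc ∣ p ∣)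
  index′ here        = zero
  index′ (there x∈p) = suc (index x∈p)
  elem-index′ : ∀ {x} (x∈p : x ∈ inside ∷ p) → elem′ (index′ x∈p) ≡ x
  elem-index′ here        = refl
  elem-index′ (there x∈p) = cong suc (elem-index x∈p)

injectiveOn-missing⇒< : ∀ {n m} (p : Subset n) (g : Fin n → Fin m) (i : Fin m)
  → InjectiveOn p g → (∀ {x} → x ∈ p → g x ≢ i) → ∣ p ∣ < m
injectiveOn-missing⇒< {m = suc m} p g i g-inj misses = s≤s (injective⇒≤ h-inj)
  where
  open Enumeration (enumerate p)
  avoids : ∀ k → i ≢ g (elem k)
  avoids k eq = misses (elem∈ k) (sym eq)
  h : Fin ∣ p ∣ → Fin m
  h k = punchOut (avoids k)
  h-inj : ∀ {k l} → h k ≡ h l → k ≡ l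
  h-inj {k} {l} eq =
    elem-inj (g-inj (elem∈ k) (elem∈ l) (punchOut-injective (avoids k) (avoids l) eq))

injectiveOn⇒hits : ∀ {n m} (p : Subset n) (g : Fin n → Fin m)
  → InjectiveOn p g → m ≤ ∣ p ∣ → ∀ i → ∃[ x ] (x ∈ p × g x ≡ i)
injectiveOn⇒hits p g g-inj m≤p i with any? (λ x → (x ∈? p) ×-dec (g x ≟ᶠ i))
... | yes hit = hit
... | no miss = ⊥-elim (<-irrefl refl (<-≤-trans (injectiveOn-missing⇒< p g i g-inj misses) m≤p))
  where
  misses : ∀ {x} → x ∈ p → g x ≢ i
  misses {x} x∈p gx≡i = miss (x , x∈p , gx≡i)

∸-half : ∀ m t → m < 2 * t → m ∸ t < t
∸-half m zero ()
∸-half m t@(suc _) lt = m<n+o⇒m∸n<o m t (subst (m <_) (cong (t +_) (+-identityʳ t)) lt)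

complement-smaller : ∀ {n} (W : Subset n) → n < 2 * ∣ W ∣ → ∣ ∁ W ∣ < ∣ W ∣
complement-smaller {n} W lt = subst (_< ∣ W ∣) (sym (∣∁p∣≡n∸∣p∣ W)) (∸-half n ∣ W ∣ lt)

record IsLabelling {n} (W : Subset n) (v : Fin n) (f : Fin n → Fin (suc ∣ W ∣)) : Set where
  field
    v-class        : f v ≡ zero
    v-alone        : ∀ {x} → f x ≡ zero → x ≡ v
    injective-in   : InjectiveOn W f
    injective-out  : ∀ {x y} → x ∉ W → y ∉ W → f x ≡ f y → x ≡ y
    representative : ∀ i → ∃[ w ] (w ∈ W × f w ≡ suc i)
    spare          : Fin ∣ W ∣
    spare-inside   : ∀ {x} → x ∉ W → f x ≢ suc spare

-- Such a labelling exists when v ∉ W and W is larger than its complement: the k-th vertex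
-- of W and the k-th vertex of ∁ W (other than v) share class k + 1.
module _ {n} (W : Subset n) (v : Fin n) (v∉W : v ∉ W) (small : ∣ ∁ W ∣ < ∣ W ∣) where

  private
    module EW = Enumeration (enumerate W)
    module EU = Enumeration (enumerate (∁ W))

    fit : ∣ ∁ W ∣ ≤ ∣ W ∣
    fit = <⇒≤ small

  label : Fin n → Fin (suc ∣ W ∣)
  label x with x ∈? W | x ≟ᶠ v
  ... | yes x∈W | _     = suc (EW.index x∈W)
  ... | no _    | yes _ = zero
  ... | no x∉W  | no _  = suc (inject≤ (EU.index (x∉p⇒x∈∁p x∉W)) fit)

  private
    label-in : ∀ {x} → x ∈ W → ∃[ k ] (EW.elem k ≡ x × label x ≡ suc k)
    label-in {x} x∈W with x ∈? W | x ≟ᶠ v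
    ... | yes x∈W′ | _  = EW.index x∈W′ , EW.elem-index x∈W′ , refl
    ... | no x∉W   | _  = ⊥-elim (x∉W x∈W)

    label-v : label v ≡ zero
    label-v with v ∈? W | v ≟ᶠ v
    ... | yes v∈W | _      = ⊥-elim (v∉W v∈W)
    ... | no _    | yes _  = refl
    ... | no _    | no v≢v = ⊥-elim (v≢v refl)

    label-out : ∀ {x} → x ∉ W
      → x ≡ v ⊎ ∃[ k ] (EU.elem k ≡ x × label x ≡ suc (inject≤ k fit))
    label-out {x} x∉W with x ∈? W | x ≟ᶠ v
    ... | yes x∈W | _       = ⊥-elim (x∉W x∈W)
    ... | no _    | yes x≡v = inj₁ x≡v
    ... | no x∉W′ | no _    = inj₂ (EU.index (x∉p⇒x∈∁p x∉W′) , EU.elem-index (x∉p⇒x∈∁p x∉W′) , refl)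

    -- Every label other than that of v is a successor.
    v-alone : ∀ {x} → label x ≡ zero → x ≡ v
    v-alone {x} eq with x ∈? W | x ≟ᶠ v
    ... | no _ | yes x≡v = x≡v

    injective-in : InjectiveOn W label
    injective-in x∈W y∈W eq with label-in x∈W | label-in y∈W
    ... | k , refl , lx | l , refl , ly =
      cong EW.elem (suc-injective (trans (sym lx) (trans eq ly)))

    injective-out : ∀ {x y} → x ∉ W → y ∉ W → label x ≡ label y → x ≡ y
    injective-out x∉W y∉W eq with label-out x∉W | label-out y∉W
    ... | inj₁ refl | inj₁ refl = refl
    ... | inj₁ refl | inj₂ (_ , _ , ly) with trans (trans (sym label-v) eq) ly
    ...   | ()
    injective-out x∉W y∉W eq | inj₂ (_ , _ , lx) | inj₁ refl with trans (trans (sym lx) eq) label-v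
    ...   | ()
    injective-out x∉W y∉W eq | inj₂ (k , refl , lx) | inj₂ (l , refl , ly) =
      cong EU.elem (inject≤-injective fit fit k l (suc-injective (trans (sym lx) (trans eq ly))))

    representative : ∀ i → ∃[ w ] (w ∈ W × label w ≡ suc i)
    representative i with label-in (EW.elem∈ i)
    ... | k , ek≡ei , lw = EW.elem i , EW.elem∈ i , trans lw (cong suc (EW.elem-inj ek≡ei))

    -- Indices of ∁ W stay below ∣ ∁ W ∣, so index ∣ ∁ W ∣ is never used outside W.
    spare : Fin ∣ W ∣
    spare = fromℕ< small

    spare-inside : ∀ {x} → x ∉ W → label x ≢ suc spare
    spare-inside x∉W eq with label-out x∉W
    ... | inj₁ refl with trans (sym label-v) eq
    ...   | ()
    spare-inside x∉W eq | inj₂ (k , _ , lx) = <-irrefl index≡size (toℕ<n k)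
      where
      index≡size : toℕ k ≡ ∣ ∁ W ∣
      index≡size = trans (sym (toℕ-inject≤ k fit))
                   (trans (cong toℕ (suc-injective (trans (sym lx) eq))) (toℕ-fromℕ< small))

  label-isLabelling : IsLabelling W v label
  label-isLabelling = record
    { v-class = label-v ; v-alone = v-alone ; injective-in = injective-in
    ; injective-out = injective-out ; representative = representative
    ; spare = spare ; spare-inside = spare-inside }

module _ {n : ℕ} (G : Graph n) where
  open Graph G renaming (sym to adj-sym)

  Clique : Subset n → Set
  Clique W = ∀ u v → u ∈ W → v ∈ W → u ≢ v → Adj u v

  Class : ∀ {k} → (Fin n → Fin k) → Fin k → Fin n → Set
  Class f i x = f x ≡ i

  Separated : ∀ {k} → (Fin n → Fin k) → Fin n → Fin n → Set
  Separated f u v = ∃[ i ] ∃[ a ] ∃[ b ]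
    (SetDist G u (Class f i) a × SetDist G v (Class f i) b × a ≢ b)

  separated-sym : ∀ {k} {f : Fin n → Fin k} {u v} → Separated f u v → Separated f v u
  separated-sym (i , a , b , sdu , sdv , a≢b) = i , b , a , sdv , sdu , λ e → a≢b (sym e)

  adjacent-distinct : ∀ {x y} → Adj x y → y ≢ x
  adjacent-distinct a refl = irrefl a

  snoc : ∀ {u v w k} → Walk G u v k → Adj v w → Walk G u w (suc k)
  snoc here       a = step a here
  snoc (step b p) a = step b (snoc p a)

  reverse : ∀ {u v k} → Walk G u v k → Walk G v u k
  reverse here       = here
  reverse (step a p) = snoc (reverse p) (adj-sym a)

  dist-sym : ∀ {u v d} → Dist G u v d → Dist G v u d
  dist-sym (p , shortest) = reverse p , λ m q → shortest m (reverse q)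

  walk? : ∀ k u v → Dec (Walk G u v k)
  walk? zero    u v = map′ (λ { refl → here }) (λ { here → refl }) (u ≟ᶠ v)
  walk? (suc k) u v = map′ (λ (w , a , p) → step a p) (λ { (step a p) → _ , a , p })
                           (any? (λ w → adj-dec u w ×-dec walk? k w v))

  walk⇒dist : ∀ {u v L} → Walk G u v L → ∃[ d ] (d ≤ L × Dist G u v d)
  walk⇒dist {u} {v} {L} p with least (λ m → walk? m u v) p
  ... | d , isDist = d , proj₂ isDist L p , isDist

  setDist-exists : (S : Fin n → Set) → (∀ x → Dec (S x))
    → ∀ {u s L} → S s → Walk G u s L → ∃[ a ] SetDist G u S a
  setDist-exists S S? {u} s∈S p
    with least (λ m → any? (λ w → S? w ×-dec walk? m u w)) (_ , s∈S , p)
  ... | a , (w , w∈S , q) , shortest =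
    a , (w , w∈S , q , λ m q′ → shortest m (w , w∈S , q′))
      , (λ w′ m w′∈S d → shortest m (w′ , w′∈S , proj₁ d))

  classDist-exists : ∀ {k} → Connected G → (f : Fin n → Fin k) → ∀ u {i s}
    → Class f i s → ∃[ a ] SetDist G u (Class f i) a
  classDist-exists conn f u {i} {s} s∈i =
    setDist-exists (Class f i) (λ x → f x ≟ᶠ i) s∈i (proj₂ (conn u s))

  setDist≤walk : ∀ {S u a s L} → SetDist G u S a → S s → Walk G u s L → a ≤ L
  setDist≤walk (_ , below) s∈S p with walk⇒dist p
  ... | d , d≤L , dist = ≤-trans (below _ d s∈S dist) d≤L

  setDist-self : ∀ {S u} → S u → SetDist G u S 0
  setDist-self {u = u} u∈S = (u , u∈S , here , λ _ _ → z≤n) , λ _ _ _ _ → z≤n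

  setDist-member : ∀ {S u a} → S u → SetDist G u S a → a ≡ 0
  setDist-member u∈S sd with setDist≤walk sd u∈S here
  ... | z≤n = refl

  setDist-nonmember : ∀ {S u a} → ¬ S u → SetDist G u S a → a ≢ 0
  setDist-nonmember u∉S ((w , w∈S , here , _) , _) refl = u∉S w∈S

  setDist-neighbour : ∀ {S u a s} → ¬ S u → S s → Adj u s → SetDist G u S a → a ≡ 1
  setDist-neighbour {a = zero}  u∉S _ _ sd = ⊥-elim (setDist-nonmember u∉S sd refl)
  setDist-neighbour {a = suc zero} _ _ _ _ = refl
  setDist-neighbour {a = suc (suc a)} _ s∈S adj sd with setDist≤walk sd s∈S (step adj here)
  ... | s≤s ()

  setDist-one⇒neighbour : ∀ {S u} → SetDist G u S 1 → ∃[ s ] (S s × Adj u s)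
  setDist-one⇒neighbour ((s , s∈S , step adj here , _) , _) = s , s∈S , adj

  setDist-singleton : ∀ {S u v a} → (∀ {x} → S x → x ≡ v) → SetDist G u S a → Dist G u v a
  setDist-singleton only-v ((s , s∈S , d) , _) = subst (λ t → Dist G _ t _) (only-v s∈S) d

  twins-sym : ∀ {u v} → Twins G u v → Twins G v u
  twins-sym tw x = ⇔-sym (tw x)

  twin-walk : ∀ {w₁ w₂ s L} → Twins G w₁ w₂ → Walk G w₂ s L → s ≢ w₂
    → ∃[ L′ ] (L′ ≤ L × Walk G w₁ s L′)
  twin-walk tw here s≢w₂ = ⊥-elim (s≢w₂ refl)
  twin-walk {w₁} tw (step {w = y} a p) _ with y ≟ᶠ w₁
  ... | yes refl = _ , n≤1+n _ , p
  ... | no y≢w₁  = _ , ≤-refl , step (proj₁ (from (tw y) (a , y≢w₁))) p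

  twins-equidistant : ∀ {S x y a b} → Twins G x y → ¬ S x → ¬ S y
    → SetDist G x S a → SetDist G y S b → a ≡ b
  twins-equidistant tw x∉S y∉S sdx sdy =
    ≤-antisym (closer tw y∉S sdx sdy) (closer (twins-sym tw) x∉S sdy sdx)
    where
    closer : ∀ {S x y a b} → Twins G x y → ¬ S y → SetDist G x S a → SetDist G y S b → a ≤ b
    closer tw y∉S sdx ((s , s∈S , p , _) , _) with twin-walk tw p (λ { refl → y∉S s∈S })
    ... | L′ , L′≤b , q = ≤-trans (setDist≤walk sdx s∈S q) L′≤b

  setDist-twinSet : ∀ {W u w b} → TwinSet G W → w ∈ W → u ∉ W → Dist G u w b
    → SetDist G u (_∈ W) b
  setDist-twinSet {W} {u} {w} {b} ts w∈W u∉W (p , shortest) = (w , w∈W , p , shortest) , below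
    where
    below : ∀ w′ m → w′ ∈ W → Dist G u w′ m → b ≤ m
    below w′ m w′∈W (q , _) with w′ ≟ᶠ w
    ... | yes refl = shortest m q
    ... | no w′≢w with twin-walk (ts w w′ w∈W w′∈W (λ e → w′≢w (sym e))) (reverse q)
                                 (λ { refl → u∉W w′∈W })
    ...   | L′ , L′≤m , r = ≤-trans (shortest L′ (reverse r)) L′≤m

  nbhd-adjacent-all : ∀ {W u w} → TwinSet G W → NbhdMinus G W u → w ∈ W → Adj u w
  nbhd-adjacent-all {W} {u} {w} ts (u∉W , w₀ , w₀∈W , a₀) w∈W with w ≟ᶠ w₀
  ... | yes refl = adj-sym a₀
  ... | no w≢w₀  = adj-sym (proj₁ (from (ts w w₀ w∈W w₀∈W w≢w₀ u) (a₀ , λ { refl → u∉W w∈W })))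

  walk-exits : ∀ {W u t k} → Walk G u t k → u ∉ W → t ∈ W → ∃[ y ] NbhdMinus G W y
  walk-exits here u∉W t∈W = ⊥-elim (u∉W t∈W)
  walk-exits {W} {u} (step {w = y} a p) u∉W t∈W with y ∈? W
  ... | yes y∈W = u , u∉W , y , y∈W , adj-sym a
  ... | no y∉W  = walk-exits p y∉W t∈W

  classes-separate : ∀ {k} → Connected G → (f : Fin n → Fin k) → ∀ {a b} → f a ≢ f b
    → Separated f a b
  classes-separate conn f {a} {b} fa≢fb with classDist-exists conn f b {f a} refl
  ... | c , sd = f a , 0 , c , setDist-self refl , sd ,
                 λ 0≡c → setDist-nonmember (λ e → fa≢fb (sym e)) sd (sym 0≡c)

  locating-splits-twins : ∀ {k} {f : Fin n → Fin k} → Locating G k f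
    → ∀ {x y} → Twins G x y → x ≢ y → f x ≢ f y
  locating-splits-twins {f = f} (_ , locates) {x} {y} tw x≢y same with locates x y x≢y
  ... | i , a , b , sdx , sdy , a≢b with f x ≟ᶠ i
  ...   | yes x∈i = a≢b (trans (setDist-member x∈i sdx)
                                (sym (setDist-member (trans (sym same) x∈i) sdy)))
  ...   | no x∉i  = a≢b (twins-equidistant tw x∉i (λ y∈i → x∉i (trans same y∈i)) sdx sdy)

  lower-bound : ∀ {W} → TwinSet G W → Clique W → ∃[ u ] NbhdMinus G W u
    → ∀ k (f : Fin n → Fin k) → Locating G k f → suc ∣ W ∣ ≤ k
  lower-bound {W} ts clique (u , u∈N) k f loc@(_ , locates) with suc ∣ W ∣ ≤? k
  ... | yes enough = enough
  ... | no few = ⊥-elim (unseparated (locates u partner u≢partner))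
    where
    injective : InjectiveOn W f
    injective {x} {y} x∈W y∈W same with x ≟ᶠ y
    ... | yes x≡y = x≡y
    ... | no x≢y  = ⊥-elim (locating-splits-twins loc (ts x y x∈W y∈W x≢y) x≢y same)
    meets : ∀ i → ∃[ w ] (w ∈ W × f w ≡ i)
    meets = injectiveOn⇒hits W f injective (m<1+n⇒m≤n (≰⇒> few))
    partner : Fin n
    partner = proj₁ (meets (f u))
    partner∈W : partner ∈ W
    partner∈W = proj₁ (proj₂ (meets (f u)))
    same-class : f partner ≡ f u
    same-class = proj₂ (proj₂ (meets (f u)))
    u≢partner : u ≢ partner
    u≢partner u≡p = proj₁ u∈N (subst (_∈ W) (sym u≡p) partner∈W)
    -- u and its partner are both at distance 0 from their own class and 1 from the others.
    unseparated : ¬ Separated f u partner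
    unseparated (i , a , b , sdu , sdp , a≢b) with f u ≟ᶠ i
    ... | yes u∈i = a≢b (trans (setDist-member u∈i sdu)
                               (sym (setDist-member (trans same-class u∈i) sdp)))
    ... | no u∉i with meets i
    ...   | wᵢ , wᵢ∈W , wᵢ∈i = a≢b (trans (setDist-neighbour u∉i wᵢ∈i u-adj sdu)
                                         (sym (setDist-neighbour p∉i wᵢ∈i p-adj sdp)))
      where
      p∉i : f partner ≢ i
      p∉i p∈i = u∉i (trans (sym same-class) p∈i)
      u-adj : Adj u wᵢ
      u-adj = nbhd-adjacent-all ts u∈N wᵢ∈W
      p-adj : Adj partner wᵢ
      p-adj = clique partner wᵢ partner∈W wᵢ∈W (λ { refl → p∉i wᵢ∈i })

  module _ {W : Subset n} {v : Fin n} {f : Fin n → Fin (suc ∣ W ∣)} (conn : Connected G)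
           (ts : TwinSet G W) (clique : Clique W) (dist : Distinguishing G W v)
           (lab : IsLabelling W v f) where
    open IsLabelling lab

    -- x ∈ N(W) \ W and w ∈ W: the class {v} separates them since v is W-distinguishing.
    separated-by-v : ∀ {x w} → NbhdMinus G W x → w ∈ W → Separated f x w
    separated-by-v {x} {w} x∈N w∈W
      with classDist-exists conn f x v-class | classDist-exists conn f w v-class
    ... | a , sdx | b , sdw = zero , a , b , sdx , sdw ,
      proj₂ dist x a b x∈N (dist-sym (setDist-singleton v-alone sdx))
            (setDist-twinSet ts w∈W (proj₁ dist) (dist-sym (setDist-singleton v-alone sdw)))

    -- x ∉ W without neighbours in W, w ∈ W in the same class: the spare class, which lies
    -- inside W, is at distance 1 from w but not from x.
    separated-by-spare : ∀ {x w} → x ∉ W → (∀ y → y ∈ W → ¬ Adj y x) → w ∈ W → f x ≡ f w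
      → Separated f x w
    separated-by-spare {x} {w} x∉W far w∈W same with representative spare
    ... | r , r∈W , r∈spare
      with classDist-exists conn f x r∈spare | classDist-exists conn f w r∈spare
    ...   | a , sdx | b , sdw = suc spare , a , b , sdx , sdw ,
                                λ a≡b → not-one (subst (SetDist G x _) (trans a≡b b≡1) sdx)
      where
      w∉spare : f w ≢ suc spare
      w∉spare e = spare-inside x∉W (trans same e)
      b≡1 : b ≡ 1
      b≡1 = setDist-neighbour w∉spare r∈spare
              (clique w r w∈W r∈W (λ { refl → w∉spare r∈spare })) sdw
      not-one : ¬ SetDist G x (Class f (suc spare)) 1
      not-one sd with setDist-one⇒neighbour sd
      ... | s , s∈spare , adj with s ∈? W
      ...   | yes s∈W = far s s∈W (adj-sym adj)
      ...   | no s∉W  = spare-inside s∉W s∈spare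

    separated-mixed : ∀ {x w} → x ∉ W → w ∈ W → f x ≡ f w → Separated f x w
    separated-mixed {x} x∉W w∈W same with any? (λ y → (y ∈? W) ×-dec adj-dec y x)
    ... | yes (y , y∈W , a) = separated-by-v (x∉W , y , y∈W , a) w∈W
    ... | no none = separated-by-spare x∉W (λ y y∈W a → none (y , y∈W , a)) w∈W same

    -- Distinct classes separate; within a class only a pair (outside W, in W) can occur.
    labelling-locating : Locating G (suc ∣ W ∣) f
    labelling-locating = covers , separated
      where
      covers : IsPartition G (suc ∣ W ∣) f
      covers zero    = v , v-class
      covers (suc i) = proj₁ (representative i) , proj₂ (proj₂ (representative i))
      separated : ∀ a b → a ≢ b → Separated f a b
      separated a b a≢b with f a ≟ᶠ f b | a ∈? W | b ∈? W
      ... | no fa≢fb | _       | _       = classes-separate conn f fa≢fb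
      ... | yes same | yes a∈W | yes b∈W = ⊥-elim (a≢b (injective-in a∈W b∈W same))
      ... | yes same | no a∉W  | no b∉W  = ⊥-elim (a≢b (injective-out a∉W b∉W same))
      ... | yes same | no a∉W  | yes b∈W = separated-mixed a∉W b∈W same
      ... | yes same | yes a∈W | no b∉W  = separated-sym (separated-mixed b∉W a∈W (sym same))

  -- An isolated vertex of G[N(W) \ W] is W-distinguishing: it is at distance 1 from W
  -- but not adjacent to any vertex of N(W) \ W.
  isolated-distinguishing : ∀ {W z} → NbhdMinus G W z → (∀ y → NbhdMinus G W y → ¬ Adj z y)
    → Distinguishing G W z
  isolated-distinguishing {W} {z} (z∉W , w , w∈W , w~z) isolated = z∉W , apart
    where
    apart : ∀ y d b → NbhdMinus G W y → Dist G z y d → SetDist G z (_∈ W) b → d ≢ b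
    apart y d b y∈N (p , _) sd d≡b with setDist-neighbour {_∈ W} z∉W w∈W (adj-sym w~z) sd
    apart y _ _ y∈N (step adj here , _) _ refl | refl = isolated y y∈N adj

  twins? : ∀ u v → Dec (Twins G u v)
  twins? u v = all? (λ x → (adj-dec u x ×-dec ¬? (x ≟ᶠ v)) ⇔? (adj-dec v x ×-dec ¬? (x ≟ᶠ u)))

  twin-class-beyond : ∀ {W w v} → TwinSet G W → w ∈ W → v ∉ W → Twins G w v
    → ∃[ C ] (TwinClass G C × ∣ W ∣ < ∣ C ∣)
  twin-class-beyond {W} {w} {v} ts w∈W v∉W tw = C , (w , member w (inj₁ refl) , ∈subsetOf⇔ P? ) ,
    p⊂q⇒∣p∣<∣q∣ ((λ {x} x∈W → member x (twin-of-w x x∈W)) , v , member v (inj₂ tw) , v∉W)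
    where
    P? : ∀ x → Dec (x ≡ w ⊎ Twins G w x)
    P? x = (x ≟ᶠ w) ⊎-dec twins? w x
    C : Subset n
    C = subsetOf P?
    member : ∀ x → x ≡ w ⊎ Twins G w x → x ∈ C
    member x = from (∈subsetOf⇔ P? x)
    twin-of-w : ∀ x → x ∈ W → x ≡ w ⊎ Twins G w x
    twin-of-w x x∈W with x ≟ᶠ w
    ... | yes x≡w = inj₁ x≡w
    ... | no x≢w  = inj₂ (ts w x w∈W x∈W (λ e → x≢w (sym e)))

  universal-twin : ∀ {W v w} → TwinSet G W → Clique W → NbhdMinus G W v
    → (∀ y → NbhdMinus G W y → y ≢ v → Adj v y) → (∀ y → Adj v y → ClosedNbhd G W y)
    → w ∈ W → Twins G w v
  universal-twin {W} {v} {w} ts clique v∈N universal inner w∈W y = mk⇔ w⇒v v⇒w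
    where
    w⇒v : Adj w y × y ≢ v → Adj v y × y ≢ w
    w⇒v (a , y≢v) with y ∈? W
    ... | yes y∈W = nbhd-adjacent-all ts v∈N y∈W , adjacent-distinct a
    ... | no y∉W  = universal y (y∉W , w , w∈W , a) y≢v , adjacent-distinct a
    v⇒w : Adj v y × y ≢ w → Adj w y × y ≢ v
    v⇒w (a , y≢w) with y ∈? W | inner y a
    ... | yes y∈W | _        = clique w y w∈W y∈W (λ e → y≢w (sym e)) , adjacent-distinct a
    ... | no y∉W  | inj₁ y∈W = ⊥-elim (y∉W y∈W)
    ... | no y∉W  | inj₂ y∈N = adj-sym (nbhd-adjacent-all ts (y∉W , y∈N) w∈W) , adjacent-distinct a

  closedNbhd? : ∀ W x → Dec (ClosedNbhd G W x)
  closedNbhd? W x = (x ∈? W) ⊎-dec any? (λ w → (w ∈? W) ×-dec adj-dec w x)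

  neighbours-inside : ∀ {W v} → ¬ (∃[ x ] (¬ ClosedNbhd G W x × Adj v x))
    → ∀ y → Adj v y → ClosedNbhd G W y
  neighbours-inside {W} none y a = decidable-stable (closedNbhd? W y) (λ y∉N → none (y , y∉N , a))

  universal-escapes : ∀ {W} → TwinNumber G ∣ W ∣ → TwinSet G W → Clique W
    → ∀ v → NbhdMinus G W v → (∀ y → NbhdMinus G W y → y ≢ v → Adj v y)
    → ∃[ x ] (¬ ClosedNbhd G W x × Adj v x)
  universal-escapes {W} tn ts clique v v∈N@(v∉W , w , w∈W , _) universal
    with any? (λ x → ¬? (closedNbhd? W x) ×-dec adj-dec v x)
  ... | yes escape = escape
  ... | no none with twin-class-beyond ts w∈W v∉W
                       (universal-twin ts clique v∈N universal (neighbours-inside none) w∈W)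
  ...   | C , class , W<C = ⊥-elim (<-irrefl refl (<-≤-trans W<C (proj₂ tn C class)))

mainTheorem18 : (n : ℕ) (G : Graph n) (τ : ℕ) (W : Subset n)
    → 2 ≤ n
    → Connected G
    → TwinNumber G τ
    → n < 2 * τ
    → TwinSet G W
    → ∣ W ∣ ≡ τ
    → (∀ u v → u ∈ W → v ∈ W → u ≢ v → Graph.Adj G u v)
    → ((∃[ v ] Distinguishing G W v) → PartitionDim G (suc τ))
    × ((∃[ z ] (NbhdMinus G W z × (∀ y → NbhdMinus G W y → ¬ Graph.Adj G z y)))
    → PartitionDim G (suc τ))
    × ((∃[ z ] (∀ y → NbhdMinus G W y ⇔ y ≡ z)) → PartitionDim G (suc τ))
    × (∀ v → NbhdMinus G W v → (∀ y → NbhdMinus G W y → y ≢ v → Graph.Adj G v y)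
    → ∃[ x ] (¬ ClosedNbhd G W x × Graph.Adj G v x))
mainTheorem18 n G .(∣ W ∣) W _ conn tn lt ts refl clique =
  partA , partB , partC , universal-escapes G tn ts clique
  where
  small : ∣ ∁ W ∣ < ∣ W ∣
  small = complement-smaller W lt
  -- W is nonempty since it is larger than its complement.
  w₀ : Fin n
  w₀ = Enumeration.elem (enumerate W) (fromℕ< (≤-<-trans z≤n small))
  w₀∈W : w₀ ∈ W
  w₀∈W = Enumeration.elem∈ (enumerate W) _
  -- Upper bound by the labelling, lower bound via a vertex of N(W) \ W on a walk v → w₀.
  partA : (∃[ v ] Distinguishing G W v) → PartitionDim G (suc ∣ W ∣)
  partA (v , dist@(v∉W , _)) =
    (label W v v∉W small ,
     labelling-locating G conn ts clique dist (label-isLabelling W v v∉W small)) ,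
    lower-bound G ts clique (walk-exits G (proj₂ (conn v w₀)) v∉W w₀∈W)
  partB : (∃[ z ] (NbhdMinus G W z × (∀ y → NbhdMinus G W y → ¬ Graph.Adj G z y)))
    → PartitionDim G (suc ∣ W ∣)
  partB (z , z∈N , isolated) = partA (z , isolated-distinguishing G z∈N isolated)
  -- The unique vertex of N(W) \ W is isolated in G[N(W) \ W].
  partC : (∃[ z ] (∀ y → NbhdMinus G W y ⇔ y ≡ z)) → PartitionDim G (suc ∣ W ∣)
  partC (z , only-z) = partB (z , from (only-z z) refl ,
    λ y y∈N a → Graph.irrefl G (subst (Graph.Adj G z) (to (only-z y) y∈N) a))
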